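{- A set $S\subseteq S_n$ is symmetric if and only if the set system $A(S)$ is harmonic.
   Context: For $w\in S_n$, $\mathrm{Des}(w)=\{i: w(i)>w(i+1)\}$; $F_{n,D}=\sum x_{i_1}\cdots x_{i_n}$ over $i_1\le\dots\le i_n$ with $i_j<i_{j+1}$ for $j\in D$; $Q(S)=\sum_{w\in S}F_{n,\mathrm{Des}(w)}$; $S$ is symmetric if $Q(S)$ is a symmetric function. A set system is $H=(U,(A_1,\dots,A_m))$ with $A_i\subseteq U$. For $I\subseteq[m]$, $H_I=\bigcap_{i\in I}A_i$ (equal to $U$ if $I=\varnothing$). The run decomposition of a finite set $I$ of positive integers is the partition of $|I|$ formed by the sizes, sorted in nonincreasing order, of the maximal runs of consecutive integers in $I$. $H$ is harmonic if $|H_I|=|H_J|$ for all $I,J\subseteq[m]$ with the same run decomposition. For $S\subseteq S_n$, $A(S)=(S,(A_1,\dots,A_{n-1}))$ with $A_i=\{\pi\in S:\pi(i)>\pi(i+1)\}$. -}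

module Defs where

open import Data.Bool using (Bool; true; false; if_then_else_; _∧_)
open import Data.Nat using (ℕ; zero; suc; _∸_; _<ᵇ_; _≡ᵇ_)
open import Data.Nat.Properties using (≤-decTotalOrder)
open import Data.List using (List; []; _∷_; _++_; replicate; length; map; reverse; upTo)
open import Data.Nat.ListAction using (sum)
open import Data.List.Sort.InsertionSort ≤-decTotalOrder using (sort)
open import Data.Vec using (Vec; toList)
open import Data.Fin.Subset using (Subset)
open import Data.List.Relation.Binary.Permutation.Propositional using (_↭_)
open import Data.List.Relation.Unary.All using (All)
open import Data.List.Relation.Unary.Unique.Propositional using (Unique)
open import Relation.Binary.PropositionalEquality using (_≡_)

allᵇ : {X : Set} → (X → Bool) → List X → Bool
allᵇ p []       = true
allᵇ p (x ∷ xs) = p x ∧ allᵇ p xs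

countᵇ : {X : Set} → (X → Bool) → List X → ℕ
countᵇ p []       = 0
countᵇ p (x ∷ xs) = if p x then suc (countᵇ p xs) else countᵇ p xs

-- 1-based indexing into a list; out of range gives 0 (never used in range).
at : List ℕ → ℕ → ℕ
at []       _             = 0
at (x ∷ xs) zero          = 0
at (x ∷ xs) (suc zero)    = x
at (x ∷ xs) (suc (suc k)) = at xs (suc k)

oneTo : ℕ → List ℕ
oneTo n = map suc (upTo n)

-- Permutations of [n] in one-line notation: w = [w(1), ..., w(n)].

IsPerm : ℕ → List ℕ → Set
IsPerm n w = w ↭ oneTo n

isDescent : List ℕ → ℕ → Bool
isDescent w i = at w (suc i) <ᵇ at w i

record PermSet (n : ℕ) : Set where
  field
    elems  : List (List ℕ)
    perms  : All (IsPerm n) elems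
    unique : Unique elems
open PermSet public

-- Formal power series in x_1, x_2, ... with ℕ coefficients, given by
-- their coefficient function on monomials.  A monomial x_1^{e_1} ... x_k^{e_k}
-- is an exponent list e = [e_1, ..., e_k] (trailing zeros are harmless).

Monomial : Set
Monomial = List ℕ

Series : Set
Series = Monomial → ℕ

-- The unique weakly increasing index word i_1 ≤ ... ≤ i_N with
-- x_{i_1} ... x_{i_N} = x^e :  1^{e_1} 2^{e_2} ...
wordFrom : ℕ → Monomial → List ℕ
wordFrom j []      = []
wordFrom j (k ∷ e) = replicate k j ++ wordFrom (suc j) e

word : Monomial → List ℕ
word = wordFrom 1

-- Coefficient of x^e in F_{n,D}, where D is given by a Boolean predicate on
-- positions 1..n-1: it is the number of sequences i_1 ≤ ... ≤ i_n with
-- i_j < i_{j+1} for j ∈ D and x_{i_1}...x_{i_n} = x^e; the only candidate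
-- sequence is word e.
F-coeff : (n : ℕ) → (D : ℕ → Bool) → Series
F-coeff n D e =
  if (length (word e) ≡ᵇ n)
     ∧ allᵇ (λ j → if D j then (at (word e) j <ᵇ at (word e) (suc j)) else true)
           (oneTo (n ∸ 1))
  then 1 else 0

Q : (n : ℕ) → PermSet n → Series
Q n S e = sum (map (λ w → F-coeff n (isDescent w) e) (elems S))

-- A formal power series is a symmetric function if it is invariant under
-- permutations of the variables, i.e. the coefficient of a monomial is
-- unchanged when its exponents are permuted among the variables.
IsSymmetricFunction : Series → Set
IsSymmetricFunction f = ∀ (e e′ : Monomial) → e ↭ e′ → f e ≡ f e′

IsSymmetric : (n : ℕ) → PermSet n → Set
IsSymmetric n S = IsSymmetricFunction (Q n S)

-- Run decomposition.  A subset I ⊆ [m] is a Subset m = Vec Bool m, whose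
-- k-th entry (0-based) says whether k+1 ∈ I.

runsAux : ℕ → List Bool → List ℕ
runsAux zero    []           = []
runsAux (suc c) []           = suc c ∷ []
runsAux c       (true ∷ bs)  = runsAux (suc c) bs
runsAux zero    (false ∷ bs) = runsAux zero bs
runsAux (suc c) (false ∷ bs) = suc c ∷ runsAux zero bs

-- sizes of maximal runs of consecutive integers in I
runs : List Bool → List ℕ
runs = runsAux zero

runDecomposition : {m : ℕ} → Subset m → List ℕ
runDecomposition I = reverse (sort (runs (toList I)))

record SetSystem (X : Set) : Set where
  field
    U    : List X          -- the ground set (duplicate-free in our use)
    m    : ℕ
    A    : ℕ → X → Bool    -- A i x : x ∈ A_i   (1 ≤ i ≤ m)
open SetSystem public

inIntersection : {X : Set} (H : SetSystem X) → List Bool → ℕ → X → Bool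
inIntersection H []          i x = true
inIntersection H (true ∷ I)  i x = A H i x ∧ inIntersection H I (suc i) x
inIntersection H (false ∷ I) i x = inIntersection H I (suc i) x

card-H : {X : Set} (H : SetSystem X) → Subset (m H) → ℕ
card-H H I = countᵇ (inIntersection H (toList I) 1) (U H)

IsHarmonic : {X : Set} → SetSystem X → Set
IsHarmonic H = ∀ (I J : Subset (m H)) →
  runDecomposition I ≡ runDecomposition J → card-H H I ≡ card-H H J

A-system : (n : ℕ) → PermSet n → SetSystem (List ℕ)
A-system n S = record { U = elems S ; m = n ∸ 1 ; A = λ i π → isDescent π i }

{-# OPTIONS --safe #-}
module Submission where

-- Both conditions say that counting the permutations of S whose descent indicator obeys
-- a pattern of constraints "free / forced descent / forced ascent" on consecutive
-- positions gives a number that does not change when the blocks of the pattern (a free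
-- position followed by forced ones) are permuted.  The coefficient of x^e in Q(S) is such
-- a count with all forced positions ascents, the blocks being the parts of e; the number
-- |A(S)_I| is such a count with all forced positions descents, the blocks being the runs
-- of I.  A free position splits as "descent" plus "ascent", so every count is a difference
-- of counts with fewer positions of the unwanted kind; by induction on that number,
-- invariance of either family of counts gives invariance for all patterns.

open import Defs
open import Data.Bool using (Bool; true; false; not; _∧_; _xor_; if_then_else_; T)
open import Data.Bool.Properties using (xor-same; ¬-not; T-≡) renaming (_≟_ to _≟ᵇ_)
open import Data.Fin.Subset using (Subset)
open import Data.List using (List; []; _∷_; _++_; length; map; replicate; concatMap; filter; reverse; upTo)
open import Data.List.Membership.Propositional using (find)
open import Data.List.Membership.Propositional.Properties using (∈-∃++; ∈-insert)
open import Data.List.Properties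
  using (++-assoc; length-++; length-map; map-++; map-cong; map-replicate; map-upTo; reverse-injective)
open import Data.List.Relation.Binary.Equality.Propositional using (≋⇒≡)
open import Data.List.Relation.Binary.Permutation.Propositional
  using (_↭_; prep; ↭-refl; ↭-sym; ↭-trans; ↭-reflexive; ↭⇒↭ₛ)
open import Data.List.Relation.Binary.Permutation.Propositional.Properties
  using (shift; drop-mid; ∈-resp-↭; ++⁺ˡ; map⁺; ↭-length; ↭-empty-inv; All-resp-↭; filter-↭)
open import Data.List.Relation.Unary.All using (All; []; _∷_; all?)
open import Data.List.Relation.Unary.All.Properties using (¬All⇒Any¬)
open import Data.List.Relation.Unary.Sorted.TotalOrder.Properties using (↗↭↗⇒≋)
open import Data.Maybe using (Maybe; just; nothing)
open import Data.Nat using (ℕ; zero; suc; pred; _+_; _∸_; _<_; _<ᵇ_; _≡ᵇ_; z<s)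
open import Data.Nat.Induction using (<-wellFounded)
open import Data.Nat.ListAction using (sum)
open import Data.Nat.ListAction.Properties using (sum-↭)
open import Data.Nat.Properties
  using (_≟_; +-suc; +-identityʳ; +-cancelˡ-≡; +-cancelʳ-≡; +-monoʳ-<; suc-injective; n<1+n; m<n⇒m<1+n;
         ≤-trans; ≤-reflexive; <⇒<ᵇ; ≡ᵇ⇒≡; nonZero?; ≤-decTotalOrder; ≤-totalOrder;
         +-commutativeSemigroup)
open import Algebra.Properties.CommutativeSemigroup +-commutativeSemigroup using (interchange; x∙yz≈y∙xz)
open import Data.List.Sort.InsertionSort ≤-decTotalOrder using (sort)
open import Data.List.Sort.InsertionSort.Properties ≤-decTotalOrder using (sort-↭; sort-↗)
open import Data.Product using (Σ-syntax; ∃; _,_)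
open import Data.Vec using (Vec; []; toList; fromList)
open import Data.Vec.Properties using (toList∘fromList; length-toList)
open import Function using (_∘_; _⇔_; mk⇔; Equivalence)
open import Function.Properties.Equivalence using () renaming (trans to ⇔-trans)
open import Induction.WellFounded using (Acc; acc)
open import Relation.Binary.PropositionalEquality
open import Relation.Nullary using (¬_; yes; no; contradiction)
open import Relation.Unary using (_∩_)

open ≡-Reasoning

private
  variable
    X : Set

indicator : Bool → ℕ
indicator b = if b then 1 else 0

sum-map-+ : (f g : X → ℕ) (xs : List X) →
            sum (map (λ x → f x + g x) xs) ≡ sum (map f xs) + sum (map g xs)
sum-map-+ f g []       = refl
sum-map-+ f g (x ∷ xs) =
  trans (cong (f x + g x +_) (sum-map-+ f g xs)) (interchange (f x) (g x) _ _)

countᵇ≡sum-indicator : (p : X → Bool) (xs : List X) → countᵇ p xs ≡ sum (map (indicator ∘ p) xs)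
countᵇ≡sum-indicator p []       = refl
countᵇ≡sum-indicator p (x ∷ xs) with p x
... | true  = cong suc (countᵇ≡sum-indicator p xs)
... | false = countᵇ≡sum-indicator p xs

countᵇ-++ : (p : X → Bool) (xs ys : List X) → countᵇ p (xs ++ ys) ≡ countᵇ p xs + countᵇ p ys
countᵇ-++ p []       ys = refl
countᵇ-++ p (x ∷ xs) ys with p x
... | true  = cong suc (countᵇ-++ p xs ys)
... | false = countᵇ-++ p xs ys

replicate-length : ∀ {x : X} {xs} → All (_≡ x) xs → replicate (length xs) x ≡ xs
replicate-length []             = refl
replicate-length (refl ∷ xs≡x) = cong (_ ∷_) (replicate-length xs≡x)

↭-insert-mid : ∀ (t : X) {xs ys xs′ ys′} →
  xs ++ ys ↭ xs′ ++ ys′ → xs ++ t ∷ ys ↭ xs′ ++ t ∷ ys′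
↭-insert-mid t {xs} {ys} {xs′} {ys′} p =
  ↭-trans (shift t xs ys) (↭-trans (prep t p) (↭-sym (shift t xs′ ys′)))

vecOfList : ∀ {m} (xs : List X) → length xs ≡ m → Σ[ v ∈ Vec X m ] toList v ≡ xs
vecOfList xs refl = fromList xs , toList∘fromList xs

reverse∘sort-≡⇔↭ : ∀ {xs ys} → reverse (sort xs) ≡ reverse (sort ys) ⇔ (xs ↭ ys)
reverse∘sort-≡⇔↭ {xs} {ys} = mk⇔
  (λ eq → ↭-trans (↭-sym (sort-↭ xs)) (↭-trans (↭-reflexive (reverse-injective eq)) (sort-↭ ys)))
  (λ p → cong reverse (≋⇒≡ (↗↭↗⇒≋ ≤-totalOrder (sort-↗ xs) (sort-↗ ys)
                             (↭⇒↭ₛ (↭-trans (sort-↭ xs) (↭-trans p (↭-sym (sort-↭ ys))))))))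

≡ᵇ-refl : ∀ n → (n ≡ᵇ n) ≡ true
≡ᵇ-refl zero    = refl
≡ᵇ-refl (suc n) = ≡ᵇ-refl n

≢⇒≡ᵇ-false : ∀ {m n} → m ≢ n → (m ≡ᵇ n) ≡ false
≢⇒≡ᵇ-false {m} {n} m≢n with m ≡ᵇ n in eq
... | true  = contradiction (≡ᵇ⇒≡ m n (subst T (sym eq) _)) m≢n
... | false = refl

-- Patterns of descent constraints

-- A pattern constrains a descent indicator d at consecutive positions: nothing leaves a
-- position free, just x forces d to be x there.
Pattern : Set
Pattern = List (Maybe Bool)

fits : Maybe Bool → Bool → Bool
fits nothing      _ = true
fits (just true)  x = x
fits (just false) x = not x

matches : Pattern → (ℕ → Bool) → ℕ → Bool
matches []      d i = true
matches (c ∷ p) d i = fits c (d i) ∧ matches p d (suc i)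

matches-suc : ∀ p (d : ℕ → Bool) i → matches p (d ∘ suc) i ≡ matches p d (suc i)
matches-suc []      d i = refl
matches-suc (c ∷ p) d i = cong (fits c (d (suc i)) ∧_) (matches-suc p d (suc i))

indicator-fits-split : ∀ x b r →
  indicator r ≡ indicator (fits (just b) x ∧ r) + indicator (fits (just (not b)) x ∧ r)
indicator-fits-split true  true  r = sym (+-identityʳ _)
indicator-fits-split true  false r = refl
indicator-fits-split false true  r = refl
indicator-fits-split false false r = sym (+-identityʳ _)

matches-free : ∀ P R b d i →
  indicator (matches (P ++ nothing ∷ R) d i)
    ≡ indicator (matches (P ++ just b ∷ R) d i) + indicator (matches (P ++ just (not b) ∷ R) d i)
matches-free []      R b d i = indicator-fits-split (d i) b (matches R d (suc i))
matches-free (c ∷ P) R b d i with fits c (d i)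
... | true  = matches-free P R b d (suc i)
... | false = refl

countMatching : List (List ℕ) → Pattern → ℕ
countMatching L p = sum (map (λ w → indicator (matches p (isDescent w) 0)) L)

FreeSplitting : (Pattern → ℕ) → Set
FreeSplitting F = ∀ P R b → F (P ++ nothing ∷ R) ≡ F (P ++ just b ∷ R) + F (P ++ just (not b) ∷ R)

countMatching-freeSplitting : ∀ L → FreeSplitting (countMatching L)
countMatching-freeSplitting L P R b =
  trans (cong sum (map-cong (λ w → matches-free P R b (isDescent w) 0) L)) (sum-map-+ _ _ L)

-- Each segment is a free position followed by one forced position per entry.  Patterns
-- are matched from position 0, a dummy position (isDescent w 0 is false), so that the
-- first segment also starts with a free position.
patternOf : List (List Bool) → Pattern
patternOf []       = []
patternOf (s ∷ ss) = nothing ∷ (map just s ++ patternOf ss)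

patternOf-++ : ∀ A B → patternOf (A ++ B) ≡ patternOf A ++ patternOf B
patternOf-++ []      B = refl
patternOf-++ (s ∷ A) B =
  cong (nothing ∷_) (trans (cong (map just s ++_) (patternOf-++ A B)) (sym (++-assoc (map just s) _ _)))

before : List (List Bool) → List Bool → Pattern
before A u = patternOf A ++ nothing ∷ map just u

after : List Bool → List (List Bool) → Pattern
after v B = map just v ++ patternOf B

patternOf-fill : ∀ A u x v B → patternOf (A ++ (u ++ x ∷ v) ∷ B) ≡ before A u ++ just x ∷ after v B
patternOf-fill A u x v B = begin
  patternOf (A ++ (u ++ x ∷ v) ∷ B)
    ≡⟨ patternOf-++ A _ ⟩
  patternOf A ++ nothing ∷ (map just (u ++ x ∷ v) ++ patternOf B)
    ≡⟨ cong (λ s → patternOf A ++ nothing ∷ (s ++ patternOf B)) (map-++ just u (x ∷ v)) ⟩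
  patternOf A ++ nothing ∷ ((map just u ++ just x ∷ map just v) ++ patternOf B)
    ≡⟨ cong (λ s → patternOf A ++ nothing ∷ s) (++-assoc (map just u) _ (patternOf B)) ⟩
  patternOf A ++ nothing ∷ (map just u ++ just x ∷ after v B)
    ≡⟨ ++-assoc (patternOf A) (nothing ∷ map just u) _ ⟨
  before A u ++ just x ∷ after v B ∎

patternOf-cut : ∀ A u v B → patternOf (A ++ u ∷ v ∷ B) ≡ before A u ++ nothing ∷ after v B
patternOf-cut A u v B =
  trans (patternOf-++ A (u ∷ v ∷ B)) (sym (++-assoc (patternOf A) (nothing ∷ map just u) _))

length-patternOf-fill : ∀ A u x v B →
  length (patternOf (A ++ (u ++ x ∷ v) ∷ B)) ≡ length (patternOf (A ++ u ∷ v ∷ B))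
length-patternOf-fill A u x v B
  rewrite patternOf-fill A u x v B | patternOf-cut A u v B
  = trans (length-++ (before A u)) (sym (length-++ (before A u)))

length-patternOf : ∀ segs → length (patternOf segs) ≡ length (map length segs) + sum (map length segs)
length-patternOf []       = refl
length-patternOf (s ∷ ss) = cong suc (begin
  length (map just s ++ patternOf ss)
    ≡⟨ length-++ (map just s) ⟩
  length (map just s) + length (patternOf ss)
    ≡⟨ cong₂ _+_ (length-map just s) (length-patternOf ss) ⟩
  length s + (length (map length ss) + sum (map length ss))
    ≡⟨ x∙yz≈y∙xz (length s) (length (map length ss)) (sum (map length ss)) ⟩
  length (map length ss) + (length s + sum (map length ss)) ∎)

length-patternOf-↭ : ∀ {segs segs′} → segs ↭ segs′ →
  length (patternOf segs) ≡ length (patternOf segs′)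
length-patternOf-↭ {segs} {segs′} p = begin
  length (patternOf segs)                             ≡⟨ length-patternOf segs ⟩
  length (map length segs) + sum (map length segs)    ≡⟨ cong₂ _+_ (↭-length lengths) (sum-↭ lengths) ⟩
  length (map length segs′) + sum (map length segs′) ≡⟨ length-patternOf segs′ ⟨
  length (patternOf segs′)                            ∎
  where
  lengths : map length segs ↭ map length segs′
  lengths = map⁺ length p

Constant : Bool → List (List Bool) → Set
Constant b = All (All (_≡ b))

OfLength : ℕ → List (List Bool) → Set
OfLength N segs = length (patternOf segs) ≡ N

PermInvariant : (Pattern → ℕ) → (List (List Bool) → Set) → Set
PermInvariant F P =
  ∀ {segs segs′} → P segs → segs ↭ segs′ → F (patternOf segs) ≡ F (patternOf segs′)

permInvariant-OfLength-0 : ∀ F → PermInvariant F (OfLength 0)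
permInvariant-OfLength-0 F {segs = []}    _  p rewrite ↭-empty-inv (↭-sym p) = refl
permInvariant-OfLength-0 F {segs = _ ∷ _} () _

constant-lengths : ∀ {x : X} {segs} → All (All (_≡ x)) segs →
  map (λ k → replicate k x) (map length segs) ≡ segs
constant-lengths []               = refl
constant-lengths (s≡x ∷ segs≡x) = cong₂ _∷_ (replicate-length s≡x) (constant-lengths segs≡x)

-- Reduction to constant patterns

splitSegment : ∀ F → FreeSplitting F → ∀ A u v B b →
  F (patternOf (A ++ u ∷ v ∷ B))
    ≡ F (patternOf (A ++ (u ++ b ∷ v) ∷ B)) + F (patternOf (A ++ (u ++ not b ∷ v) ∷ B))
splitSegment F split A u v B b
  rewrite patternOf-cut A u v B | patternOf-fill A u b v B | patternOf-fill A u (not b) v B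
  = split (before A u) (after v B) b

conflicts : Bool → Maybe Bool → Bool
conflicts b nothing  = false
conflicts b (just x) = x xor b

defects : Bool → List (List Bool) → ℕ
defects b segs = countᵇ (conflicts b) (patternOf segs)

not-xor-self : ∀ b → not b xor b ≡ true
not-xor-self true  = refl
not-xor-self false = refl

defects-cut<fill : ∀ b A u v B → defects b (A ++ u ∷ v ∷ B) < defects b (A ++ (u ++ not b ∷ v) ∷ B)
defects-cut<fill b A u v B
  rewrite patternOf-cut A u v B | patternOf-fill A u (not b) v B
        | countᵇ-++ (conflicts b) (before A u) (nothing ∷ after v B)
        | countᵇ-++ (conflicts b) (before A u) (just (not b) ∷ after v B)
        | not-xor-self b
  = +-monoʳ-< (countᵇ (conflicts b) (before A u)) (n<1+n _)

defects-fill≡cut : ∀ b A u v B → defects b (A ++ (u ++ b ∷ v) ∷ B) ≡ defects b (A ++ u ∷ v ∷ B)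
defects-fill≡cut b A u v B
  rewrite patternOf-cut A u v B | patternOf-fill A u b v B
        | countᵇ-++ (conflicts b) (before A u) (nothing ∷ after v B)
        | countᵇ-++ (conflicts b) (before A u) (just b ∷ after v B)
        | xor-same b
  = refl

locateDefect : ∀ {b} segs → ¬ Constant b segs →
  ∃ λ A → ∃ λ u → ∃ λ v → ∃ λ B → segs ≡ A ++ (u ++ not b ∷ v) ∷ B
locateDefect {b} segs ¬const
  with s , s∈segs , ¬const-s ← find (¬All⇒Any¬ (all? (_≟ᵇ b)) segs ¬const)
  with x , x∈s , x≢b ← find (¬All⇒Any¬ (_≟ᵇ b) s ¬const-s)
  with A , B , refl ← ∈-∃++ s∈segs
  with u , v , refl ← ∈-∃++ x∈s
  = A , u , v , B , cong (λ y → A ++ (u ++ y ∷ v) ∷ B) (¬-not x≢b)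

permInvariant-fromConstant : ∀ F → FreeSplitting F → ∀ b N →
  PermInvariant F (Constant b ∩ OfLength N) → PermInvariant F (OfLength N)
permInvariant-fromConstant F split b N invariant {segs} = go segs (<-wellFounded (defects b segs))
  where
  go : ∀ segs {segs′} → Acc _<_ (defects b segs) → OfLength N segs → segs ↭ segs′ →
       F (patternOf segs) ≡ F (patternOf segs′)
  go segs (acc smaller) len p with all? (all? (_≟ᵇ b)) segs
  ... | yes const = invariant (const , len) p
  ... | no ¬const
    with A , u , v , B , refl ← locateDefect segs ¬const
    -- The segment u ++ not b ∷ v counts as the cut u , v minus the filling u ++ b ∷ v, both
    -- with fewer defects, and the same splitting applies to the permuted list.
    with A′ , B′ , refl ← ∈-∃++ (∈-resp-↭ p (∈-insert A))
    = +-cancelˡ-≡ (F (patternOf (A ++ (u ++ b ∷ v) ∷ B))) _ _ (begin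
      F (patternOf (A ++ (u ++ b ∷ v) ∷ B)) + F (patternOf (A ++ (u ++ not b ∷ v) ∷ B))
        ≡⟨ splitSegment F split A u v B b ⟨
      F (patternOf (A ++ u ∷ v ∷ B))
        ≡⟨ go _ (smaller cut<) len-cut (↭-insert-mid u (↭-insert-mid v rest)) ⟩
      F (patternOf (A′ ++ u ∷ v ∷ B′))
        ≡⟨ splitSegment F split A′ u v B′ b ⟩
      F (patternOf (A′ ++ (u ++ b ∷ v) ∷ B′)) + F (patternOf (A′ ++ (u ++ not b ∷ v) ∷ B′))
        ≡⟨ cong (_+ F (patternOf (A′ ++ (u ++ not b ∷ v) ∷ B′)))
                (go _ (smaller fill<) len-fill (↭-insert-mid (u ++ b ∷ v) rest)) ⟨
      F (patternOf (A ++ (u ++ b ∷ v) ∷ B)) + F (patternOf (A′ ++ (u ++ not b ∷ v) ∷ B′)) ∎)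
    where
    rest : A ++ B ↭ A′ ++ B′
    rest = drop-mid A A′ p
    cut< : defects b (A ++ u ∷ v ∷ B) < defects b (A ++ (u ++ not b ∷ v) ∷ B)
    cut< = defects-cut<fill b A u v B
    fill< : defects b (A ++ (u ++ b ∷ v) ∷ B) < defects b (A ++ (u ++ not b ∷ v) ∷ B)
    fill< = ≤-trans (≤-reflexive (cong suc (defects-fill≡cut b A u v B))) cut<
    len-cut : OfLength N (A ++ u ∷ v ∷ B)
    len-cut = trans (sym (length-patternOf-fill A u (not b) v B)) len
    len-fill : OfLength N (A ++ (u ++ b ∷ v) ∷ B)
    len-fill = trans (length-patternOf-fill A u b v B) len-cut

-- Monomials and the quasisymmetric expansion

nonzeros : List ℕ → List ℕ
nonzeros = filter nonZero?

-- The composition of n formed by the nonzero exponents of x^e; a part k is the block of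
-- k equal letters of word e, i.e. a free position followed by k - 1 forced ascents.
segmentsOf : Monomial → List (List Bool)
segmentsOf e = map (λ k → replicate (pred k) false) (nonzeros e)

segmentsOf-↭ : ∀ {e e′} → e ↭ e′ → segmentsOf e ↭ segmentsOf e′
segmentsOf-↭ p = map⁺ _ (filter-↭ nonZero? p)

segmentsOf-lengths : ∀ {segs} → Constant false segs → segmentsOf (map (suc ∘ length) segs) ≡ segs
segmentsOf-lengths []                 = refl
segmentsOf-lengths (s≡false ∷ segs≡false) =
  cong₂ _∷_ (replicate-length s≡false) (segmentsOf-lengths segs≡false)

-- ascents a w forbids a descent wherever the word a w does not strictly increase, which
-- is how F_{n,D} constrains D.
ascentConstraint : ℕ → ℕ → Maybe Bool
ascentConstraint a b = if a <ᵇ b then nothing else just false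

ascents : ℕ → List ℕ → Pattern
ascents a []      = []
ascents a (b ∷ w) = ascentConstraint a b ∷ ascents b w

length-ascents : ∀ a w → length (ascents a w) ≡ length w
length-ascents a []      = refl
length-ascents a (b ∷ w) = cong suc (length-ascents b w)

ascentConstraint-< : ∀ {a b} → a < b → ascentConstraint a b ≡ nothing
ascentConstraint-< a<b rewrite Equivalence.to T-≡ (<⇒<ᵇ a<b) = refl

ascentConstraint-refl : ∀ a → ascentConstraint a a ≡ just false
ascentConstraint-refl zero    = refl
ascentConstraint-refl (suc a) = ascentConstraint-refl a

fits-ascentConstraint : ∀ a b {x} → x ≡ false → fits (ascentConstraint a b) x ≡ true
fits-ascentConstraint a b refl with a <ᵇ b
... | true  = refl
... | false = refl

ascents-replicate : ∀ k a w → ascents a (replicate k a ++ w) ≡ replicate k (just false) ++ ascents a w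
ascents-replicate zero    a w = refl
ascents-replicate (suc k) a w = cong₂ _∷_ (ascentConstraint-refl a) (ascents-replicate k a w)

ascents-wordFrom : ∀ e {a j} → a < j → ascents a (wordFrom j e) ≡ patternOf (segmentsOf e)
ascents-wordFrom []          a<j = refl
ascents-wordFrom (zero ∷ e)  a<j = ascents-wordFrom e (m<n⇒m<1+n a<j)
ascents-wordFrom (suc k ∷ e) {j = j} a<j = cong₂ _∷_ (ascentConstraint-< a<j) (begin
  ascents j (replicate k j ++ wordFrom (suc j) e)
    ≡⟨ ascents-replicate k j _ ⟩
  replicate k (just false) ++ ascents j (wordFrom (suc j) e)
    ≡⟨ cong₂ _++_ (sym (map-replicate just k false)) (ascents-wordFrom e (n<1+n j)) ⟩
  map just (replicate k false) ++ patternOf (segmentsOf e) ∎)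

patternOf-segmentsOf : ∀ e → patternOf (segmentsOf e) ≡ ascents 0 (word e)
patternOf-segmentsOf e = sym (ascents-wordFrom e z<s)

length-patternOf-segmentsOf : ∀ e → length (patternOf (segmentsOf e)) ≡ length (word e)
length-patternOf-segmentsOf e = trans (cong length (patternOf-segmentsOf e)) (length-ascents 0 (word e))

length-word-↭ : ∀ {e e′} → e ↭ e′ → length (word e) ≡ length (word e′)
length-word-↭ {e} {e′} p = begin
  length (word e)                   ≡⟨ length-patternOf-segmentsOf e ⟨
  length (patternOf (segmentsOf e))  ≡⟨ length-patternOf-↭ (segmentsOf-↭ p) ⟩
  length (patternOf (segmentsOf e′)) ≡⟨ length-patternOf-segmentsOf e′ ⟩
  length (word e′)                  ∎

strictOnDescent : List ℕ → (ℕ → Bool) → ℕ → Bool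
strictOnDescent W D j = if D j then at W j <ᵇ at W (suc j) else true

if-else-true≡fits : ∀ d c → (if d then c else true) ≡ fits (if c then nothing else just false) d
if-else-true≡fits true  true  = refl
if-else-true≡fits true  false = refl
if-else-true≡fits false true  = refl
if-else-true≡fits false false = refl

allᵇ-map : ∀ {Y : Set} (p : Y → Bool) (f : X → Y) xs → allᵇ p (map f xs) ≡ allᵇ (p ∘ f) xs
allᵇ-map p f []       = refl
allᵇ-map p f (x ∷ xs) = cong (p (f x) ∧_) (allᵇ-map p f xs)

oneTo-suc : ∀ n → oneTo (suc n) ≡ 1 ∷ map suc (oneTo n)
oneTo-suc n = cong (λ xs → 1 ∷ map suc xs) (sym (map-upTo suc n))

allᵇ-strictOnDescent : ∀ a w D →
  allᵇ (strictOnDescent (a ∷ w) D) (oneTo (length w)) ≡ matches (ascents a w) D 1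
allᵇ-strictOnDescent a []      D = refl
allᵇ-strictOnDescent a (b ∷ w) D = begin
  allᵇ test (oneTo (suc (length w)))
    ≡⟨ cong (allᵇ test) (oneTo-suc (length w)) ⟩
  test 1 ∧ allᵇ test (map suc (oneTo (length w)))
    ≡⟨ cong₂ _∧_ (if-else-true≡fits (D 1) (a <ᵇ b)) shifted ⟩
  fits (ascentConstraint a b) (D 1) ∧ allᵇ test′ (oneTo (length w))
    ≡⟨ cong (fits (ascentConstraint a b) (D 1) ∧_) (allᵇ-strictOnDescent b w (D ∘ suc)) ⟩
  fits (ascentConstraint a b) (D 1) ∧ matches (ascents b w) (D ∘ suc) 1
    ≡⟨ cong (fits (ascentConstraint a b) (D 1) ∧_) (matches-suc (ascents b w) D 1) ⟩
  matches (ascents a (b ∷ w)) D 1 ∎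
  where
  test test′ : ℕ → Bool
  test  = strictOnDescent (a ∷ b ∷ w) D
  test′ = strictOnDescent (b ∷ w) (D ∘ suc)
  -- test (2 + j) is test′ (1 + j) by definition, but test 1 and test′ 0 differ: the shift
  -- is only valid on oneTo, hence the detour through upTo.
  shifted : allᵇ test (map suc (oneTo (length w))) ≡ allᵇ test′ (oneTo (length w))
  shifted = trans (allᵇ-map test suc (oneTo (length w)))
                  (trans (allᵇ-map (test ∘ suc) suc (upTo (length w)))
                         (sym (allᵇ-map test′ suc (upTo (length w)))))

F-coeff-onLength : ∀ e D → D 0 ≡ false →
  F-coeff (length (word e)) D e ≡ indicator (matches (patternOf (segmentsOf e)) D 0)
F-coeff-onLength e D D0≡false = begin
  F-coeff (length (word e)) D e
    ≡⟨ cong (λ c → indicator (c ∧ allᵇ (strictOnDescent (word e) D) (oneTo (length (word e) ∸ 1))))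
            (≡ᵇ-refl (length (word e))) ⟩
  indicator (allᵇ (strictOnDescent (word e) D) (oneTo (length (word e) ∸ 1)))
    ≡⟨ cong indicator (allᵇ-word (word e)) ⟩
  indicator (matches (ascents 0 (word e)) D 0)
    ≡⟨ cong (λ p → indicator (matches p D 0)) (patternOf-segmentsOf e) ⟨
  indicator (matches (patternOf (segmentsOf e)) D 0) ∎
  where
  allᵇ-word : ∀ W → allᵇ (strictOnDescent W D) (oneTo (length W ∸ 1)) ≡ matches (ascents 0 W) D 0
  allᵇ-word []      = refl
  allᵇ-word (a ∷ w) = trans (allᵇ-strictOnDescent a w D)
    (cong (_∧ matches (ascents a w) D 1) (sym (fits-ascentConstraint 0 a D0≡false)))

F-coeff-offLength : ∀ {n} e D → length (word e) ≢ n → F-coeff n D e ≡ 0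
F-coeff-offLength {n} e D ≢n =
  cong (λ c → indicator (c ∧ allᵇ (strictOnDescent (word e) D) (oneTo (n ∸ 1)))) (≢⇒≡ᵇ-false ≢n)

isDescent-0 : ∀ w → isDescent w 0 ≡ false
isDescent-0 []      = refl
isDescent-0 (_ ∷ _) = refl

Q≡countMatching : ∀ {n} (S : PermSet n) e → length (word e) ≡ n →
  Q n S e ≡ countMatching (elems S) (patternOf (segmentsOf e))
Q≡countMatching S e refl =
  cong sum (map-cong (λ w → F-coeff-onLength e (isDescent w) (isDescent-0 w)) (elems S))

symmetric⇒constantInvariant : ∀ {n} (S : PermSet n) → IsSymmetric n S →
  PermInvariant (countMatching (elems S)) (Constant false ∩ OfLength n)
symmetric⇒constantInvariant {n} S symmetric {segs} {segs′} (const , len) p = begin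
  countMatching (elems S) (patternOf segs)    ≡⟨ Q-exponents const len ⟨
  Q n S (exponents segs)                      ≡⟨ symmetric _ _ (map⁺ _ p) ⟩
  Q n S (exponents segs′)                     ≡⟨ Q-exponents const′ len′ ⟩
  countMatching (elems S) (patternOf segs′)   ∎
  where
  const′ : Constant false segs′
  const′ = All-resp-↭ p const
  len′ : OfLength n segs′
  len′ = trans (length-patternOf-↭ (↭-sym p)) len
  exponents : List (List Bool) → Monomial
  exponents = map (suc ∘ length)
  Q-exponents : ∀ {ss} → Constant false ss → OfLength n ss →
    Q n S (exponents ss) ≡ countMatching (elems S) (patternOf ss)
  Q-exponents {ss} ss≡false ss-len =
    trans (Q≡countMatching S (exponents ss) length-word)
          (cong (countMatching (elems S) ∘ patternOf) (segmentsOf-lengths ss≡false))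
    where
    length-word : length (word (exponents ss)) ≡ n
    length-word = begin
      length (word (exponents ss))                   ≡⟨ length-patternOf-segmentsOf (exponents ss) ⟨
      length (patternOf (segmentsOf (exponents ss))) ≡⟨ cong (length ∘ patternOf) (segmentsOf-lengths ss≡false) ⟩
      length (patternOf ss)                          ≡⟨ ss-len ⟩
      n                                              ∎

invariant⇒symmetric : ∀ {n} (S : PermSet n) →
  PermInvariant (countMatching (elems S)) (OfLength n) → IsSymmetric n S
invariant⇒symmetric {n} S invariant e e′ p with length (word e) ≟ n
... | yes len = begin
  Q n S e
    ≡⟨ Q≡countMatching S e len ⟩
  countMatching (elems S) (patternOf (segmentsOf e))
    ≡⟨ invariant (trans (length-patternOf-segmentsOf e) len) (segmentsOf-↭ p) ⟩
  countMatching (elems S) (patternOf (segmentsOf e′))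
    ≡⟨ Q≡countMatching S e′ (trans (sym (length-word-↭ p)) len) ⟨
  Q n S e′ ∎
... | no ¬len =
  cong sum (map-cong (λ w → trans (F-coeff-offLength e _ ¬len) (sym (F-coeff-offLength e′ _ ¬len′))) (elems S))
  where
  ¬len′ : length (word e′) ≢ n
  ¬len′ = ¬len ∘ trans (length-word-↭ p)

symmetric⇒invariant : ∀ {n} (S : PermSet n) →
  IsSymmetric n S → PermInvariant (countMatching (elems S)) (OfLength n)
symmetric⇒invariant {n} S symmetric =
  permInvariant-fromConstant (countMatching (elems S)) (countMatching-freeSplitting (elems S)) false n
    (symmetric⇒constantInvariant S symmetric)

symmetric⇔invariant : ∀ {n} (S : PermSet n) →
  IsSymmetric n S ⇔ PermInvariant (countMatching (elems S)) (OfLength n)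
symmetric⇔invariant S = mk⇔ (symmetric⇒invariant S) (invariant⇒symmetric S)

-- Subsets, runs and the set system A(S)

required : Bool → Maybe Bool
required true  = just true
required false = nothing

inIntersection≡matches : ∀ {n} (S : PermSet n) bs i π →
  inIntersection (A-system n S) bs i π ≡ matches (map required bs) (isDescent π) i
inIntersection≡matches S []           i π = refl
inIntersection≡matches S (true  ∷ bs) i π =
  cong (isDescent π i ∧_) (inIntersection≡matches S bs (suc i) π)
inIntersection≡matches S (false ∷ bs) i π = inIntersection≡matches S bs (suc i) π

-- The runs of a subset, empty ones included: its indicator list cut at the non-members.
leadingRun : List Bool → List Bool
leadingRun []          = []
leadingRun (true  ∷ b) = true ∷ leadingRun b
leadingRun (false ∷ b) = []

laterRuns : List Bool → List (List Bool)
laterRuns []          = []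
laterRuns (true  ∷ b) = laterRuns b
laterRuns (false ∷ b) = leadingRun b ∷ laterRuns b

runSegments : List Bool → List (List Bool)
runSegments b = leadingRun b ∷ laterRuns b

patternOf-runSegments : ∀ b → patternOf (runSegments b) ≡ nothing ∷ map required b
patternOf-runSegments b = cong (nothing ∷_) (runs-pattern b)
  where
  runs-pattern : ∀ b → map just (leadingRun b) ++ patternOf (laterRuns b) ≡ map required b
  runs-pattern []          = refl
  runs-pattern (true  ∷ b) = cong (just true ∷_) (runs-pattern b)
  runs-pattern (false ∷ b) = cong (nothing ∷_) (runs-pattern b)

length-patternOf-runSegments : ∀ b → length (patternOf (runSegments b)) ≡ suc (length b)
length-patternOf-runSegments b = trans (cong length (patternOf-runSegments b)) (cong suc (length-map required b))

leadingRun-true : ∀ b → All (_≡ true) (leadingRun b)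
leadingRun-true []          = []
leadingRun-true (true  ∷ b) = refl ∷ leadingRun-true b
leadingRun-true (false ∷ b) = []

laterRuns-true : ∀ b → Constant true (laterRuns b)
laterRuns-true []          = []
laterRuns-true (true  ∷ b) = laterRuns-true b
laterRuns-true (false ∷ b) = leadingRun-true b ∷ laterRuns-true b

runSegments-true : ∀ b → Constant true (runSegments b)
runSegments-true b = leadingRun-true b ∷ laterRuns-true b

runsAux-runSegments : ∀ c b → runsAux c b ≡ nonzeros (c + length (leadingRun b) ∷ map length (laterRuns b))
runsAux-runSegments zero    []          = refl
runsAux-runSegments (suc c) []          = cong (λ k → nonzeros (k ∷ [])) (sym (+-identityʳ (suc c)))
runsAux-runSegments zero    (true  ∷ b) = runsAux-runSegments 1 b
runsAux-runSegments (suc c) (true  ∷ b) =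
  trans (runsAux-runSegments (suc (suc c)) b)
        (cong (λ k → nonzeros (k ∷ map length (laterRuns b))) (sym (+-suc (suc c) _)))
runsAux-runSegments zero    (false ∷ b) = runsAux-runSegments 0 b
runsAux-runSegments (suc c) (false ∷ b) =
  trans (cong (suc c ∷_) (runsAux-runSegments 0 b))
        (cong (λ k → nonzeros (k ∷ map length (laterRuns (false ∷ b)))) (sym (+-identityʳ (suc c))))

runs≡nonzeros : ∀ b → runs b ≡ nonzeros (map length (runSegments b))
runs≡nonzeros = runsAux-runSegments 0

zeros : List ℕ → ℕ
zeros []           = 0
zeros (zero  ∷ ks) = suc (zeros ks)
zeros (suc _ ∷ ks) = zeros ks

↭-zeros++nonzeros : ∀ ks → ks ↭ replicate (zeros ks) 0 ++ nonzeros ks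
↭-zeros++nonzeros []           = ↭-refl
↭-zeros++nonzeros (zero  ∷ ks) = prep 0 (↭-zeros++nonzeros ks)
↭-zeros++nonzeros (suc k ∷ ks) =
  ↭-trans (prep (suc k) (↭-zeros++nonzeros ks)) (↭-sym (shift (suc k) (replicate (zeros ks) 0) (nonzeros ks)))

length≡zeros+nonzeros : ∀ ks → length ks ≡ zeros ks + length (nonzeros ks)
length≡zeros+nonzeros []           = refl
length≡zeros+nonzeros (zero  ∷ ks) = cong suc (length≡zeros+nonzeros ks)
length≡zeros+nonzeros (suc _ ∷ ks) = trans (cong suc (length≡zeros+nonzeros ks)) (sym (+-suc (zeros ks) _))

sum-nonzeros : ∀ ks → sum (nonzeros ks) ≡ sum ks
sum-nonzeros []           = refl
sum-nonzeros (zero  ∷ ks) = sum-nonzeros ks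
sum-nonzeros (suc k ∷ ks) = cong (suc k +_) (sum-nonzeros ks)

-- The number of zeros is recovered from length + sum, which nonzeros forgets.
↭-fromNonzeros : ∀ ks ks′ → length ks + sum ks ≡ length ks′ + sum ks′ →
  nonzeros ks ↭ nonzeros ks′ → ks ↭ ks′
↭-fromNonzeros ks ks′ size p =
  ↭-trans (↭-zeros++nonzeros ks)
    (↭-trans (↭-reflexive (cong (λ z → replicate z 0 ++ nonzeros ks) same-zeros))
      (↭-trans (++⁺ˡ (replicate (zeros ks′) 0) p) (↭-sym (↭-zeros++nonzeros ks′))))
  where
  same-zeros : zeros ks ≡ zeros ks′
  same-zeros = +-cancelʳ-≡ (length (nonzeros ks)) _ _ (+-cancelʳ-≡ (sum (nonzeros ks)) _ _ (begin
    zeros ks + length (nonzeros ks) + sum (nonzeros ks)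
      ≡⟨ cong₂ _+_ (length≡zeros+nonzeros ks) (sym (sum-nonzeros ks)) ⟨
    length ks + sum ks
      ≡⟨ size ⟩
    length ks′ + sum ks′
      ≡⟨ cong₂ _+_ (length≡zeros+nonzeros ks′) (sym (sum-nonzeros ks′)) ⟩
    zeros ks′ + length (nonzeros ks′) + sum (nonzeros ks′)
      ≡⟨ cong₂ (λ ℓ σ → zeros ks′ + ℓ + σ) (↭-length p) (sum-↭ p) ⟨
    zeros ks′ + length (nonzeros ks) + sum (nonzeros ks) ∎))

runs-↭ : ∀ {b b′} → runSegments b ↭ runSegments b′ → runs b ↭ runs b′
runs-↭ {b} {b′} p =
  subst₂ _↭_ (sym (runs≡nonzeros b)) (sym (runs≡nonzeros b′)) (filter-↭ nonZero? (map⁺ length p))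

runSegments-↭ : ∀ {b b′} → length b ≡ length b′ →
  runs b ↭ runs b′ → runSegments b ↭ runSegments b′
runSegments-↭ {b} {b′} len p =
  subst₂ _↭_ (constant-lengths (runSegments-true b)) (constant-lengths (runSegments-true b′))
    (map⁺ (λ k → replicate k true)
      (↭-fromNonzeros _ _ size (subst₂ _↭_ (runs≡nonzeros b) (runs≡nonzeros b′) p)))
  where
  size : length (map length (runSegments b)) + sum (map length (runSegments b))
       ≡ length (map length (runSegments b′)) + sum (map length (runSegments b′))
  size = begin
    length (map length (runSegments b)) + sum (map length (runSegments b))
      ≡⟨ length-patternOf (runSegments b) ⟨
    length (patternOf (runSegments b))
      ≡⟨ length-patternOf-runSegments b ⟩
    suc (length b)
      ≡⟨ cong suc len ⟩
    suc (length b′)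
      ≡⟨ length-patternOf-runSegments b′ ⟨
    length (patternOf (runSegments b′))
      ≡⟨ length-patternOf (runSegments b′) ⟩
    length (map length (runSegments b′)) + sum (map length (runSegments b′)) ∎

joinRuns : List Bool → List (List Bool) → List Bool
joinRuns s ts = s ++ concatMap (false ∷_) ts

leadingRun-joinRuns : ∀ {s} ts → All (_≡ true) s → leadingRun (joinRuns s ts) ≡ s
leadingRun-joinRuns []      []              = refl
leadingRun-joinRuns (_ ∷ _) []              = refl
leadingRun-joinRuns ts      (refl ∷ s≡true) = cong (true ∷_) (leadingRun-joinRuns ts s≡true)

laterRuns-joinRuns : ∀ {s ts} → Constant true (s ∷ ts) → laterRuns (joinRuns s ts) ≡ ts
laterRuns-joinRuns {[]}    {[]}     _                          = refl
laterRuns-joinRuns {[]}    {t ∷ ts} (_ ∷ t≡true ∷ ts≡true)    =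
  cong₂ _∷_ (leadingRun-joinRuns ts t≡true) (laterRuns-joinRuns (t≡true ∷ ts≡true))
laterRuns-joinRuns {_ ∷ _} ((refl ∷ s≡true) ∷ ts≡true) =
  laterRuns-joinRuns (s≡true ∷ ts≡true)

runSegments-joinRuns : ∀ {s ts} → Constant true (s ∷ ts) → runSegments (joinRuns s ts) ≡ s ∷ ts
runSegments-joinRuns {ts = ts} const@(s≡true ∷ _) =
  cong₂ _∷_ (leadingRun-joinRuns ts s≡true) (laterRuns-joinRuns const)

subsetOfRuns : ∀ {m segs} → Constant true segs → OfLength (suc m) segs →
  Σ[ I ∈ Subset m ] runSegments (toList I) ≡ segs
subsetOfRuns {m} {s ∷ ts} const len
  with I , I≡b ← vecOfList (joinRuns s ts) (suc-injective (begin
    suc (length (joinRuns s ts))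
      ≡⟨ length-patternOf-runSegments (joinRuns s ts) ⟨
    length (patternOf (runSegments (joinRuns s ts)))
      ≡⟨ cong (length ∘ patternOf) (runSegments-joinRuns const) ⟩
    length (patternOf (s ∷ ts))
      ≡⟨ len ⟩
    suc m ∎))
  = I , trans (cong runSegments I≡b) (runSegments-joinRuns const)

card-H≡countMatching : ∀ {n} (S : PermSet n) (I : Subset (n ∸ 1)) →
  card-H (A-system n S) I ≡ countMatching (elems S) (patternOf (runSegments (toList I)))
card-H≡countMatching {n} S I = begin
  card-H (A-system n S) I
    ≡⟨ countᵇ≡sum-indicator _ (elems S) ⟩
  sum (map (indicator ∘ inIntersection (A-system n S) (toList I) 1) (elems S))
    ≡⟨ cong sum (map-cong (λ π → cong indicator (inIntersection≡matches S (toList I) 1 π)) (elems S)) ⟩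
  countMatching (elems S) (nothing ∷ map required (toList I))
    ≡⟨ cong (countMatching (elems S)) (patternOf-runSegments (toList I)) ⟨
  countMatching (elems S) (patternOf (runSegments (toList I))) ∎

harmonic⇒constantInvariant : ∀ {m} (S : PermSet (suc m)) → IsHarmonic (A-system (suc m) S) →
  PermInvariant (countMatching (elems S)) (Constant true ∩ OfLength (suc m))
harmonic⇒constantInvariant {m} S harmonic {segs} {segs′} (const , len) p
  with I , I≡segs  ← subsetOfRuns const len
  with J , J≡segs′ ← subsetOfRuns (All-resp-↭ p const) (trans (length-patternOf-↭ (↭-sym p)) len)
  = begin
  countMatching (elems S) (patternOf segs)
    ≡⟨ cong (countMatching (elems S) ∘ patternOf) I≡segs ⟨
  countMatching (elems S) (patternOf (runSegments (toList I)))
    ≡⟨ card-H≡countMatching S I ⟨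
  card-H (A-system (suc m) S) I
    ≡⟨ harmonic I J (Equivalence.from reverse∘sort-≡⇔↭ runs-I↭J) ⟩
  card-H (A-system (suc m) S) J
    ≡⟨ card-H≡countMatching S J ⟩
  countMatching (elems S) (patternOf (runSegments (toList J)))
    ≡⟨ cong (countMatching (elems S) ∘ patternOf) J≡segs′ ⟩
  countMatching (elems S) (patternOf segs′) ∎
  where
  runs-I↭J : runs (toList I) ↭ runs (toList J)
  runs-I↭J = runs-↭ (subst₂ _↭_ (sym I≡segs) (sym J≡segs′) p)

invariant⇒harmonic : ∀ {n} (S : PermSet n) → PermInvariant (countMatching (elems S)) (OfLength n) →
  IsHarmonic (A-system n S)
invariant⇒harmonic {zero}  S _         [] [] _         = refl
invariant⇒harmonic {suc m} S invariant I  J  same-runs = begin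
  card-H (A-system (suc m) S) I                               ≡⟨ card-H≡countMatching S I ⟩
  countMatching (elems S) (patternOf (runSegments (toList I))) ≡⟨ invariant (ofLength I) runSegments-I↭J ⟩
  countMatching (elems S) (patternOf (runSegments (toList J))) ≡⟨ card-H≡countMatching S J ⟨
  card-H (A-system (suc m) S) J                               ∎
  where
  ofLength : ∀ (K : Subset m) → OfLength (suc m) (runSegments (toList K))
  ofLength K = trans (length-patternOf-runSegments (toList K)) (cong suc (length-toList K))
  runSegments-I↭J : runSegments (toList I) ↭ runSegments (toList J)
  runSegments-I↭J = runSegments-↭ (trans (length-toList I) (sym (length-toList J)))
                                  (Equivalence.to reverse∘sort-≡⇔↭ same-runs)

harmonic⇒invariant : ∀ {n} (S : PermSet n) → IsHarmonic (A-system n S) →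
  PermInvariant (countMatching (elems S)) (OfLength n)
harmonic⇒invariant {zero}  S _        = permInvariant-OfLength-0 (countMatching (elems S))
harmonic⇒invariant {suc m} S harmonic =
  permInvariant-fromConstant (countMatching (elems S)) (countMatching-freeSplitting (elems S)) true (suc m)
    (harmonic⇒constantInvariant S harmonic)

invariant⇔harmonic : ∀ {n} (S : PermSet n) →
  PermInvariant (countMatching (elems S)) (OfLength n) ⇔ IsHarmonic (A-system n S)
invariant⇔harmonic S = mk⇔ (invariant⇒harmonic S) (harmonic⇒invariant S)

proposition3p14 : (n : ℕ) (S : PermSet n) → IsSymmetric n S ⇔ IsHarmonic (A-system n S)
proposition3p14 n S = ⇔-trans (symmetric⇔invariant S) (invariant⇔harmonic S)
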